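{- Let $n\ge 2$, let $A\subseteq[n]$ be nonempty, let $w$ be the largest element of $A$ and $A'=A\setminus\{w\}$. If $w=n-1$, then $f_n(A)=2f_{n-1}(A')$.
   Context: The set of alternatives is $[m]=\{1,\dots,m\}$ with its natural order. For a triple $i<j<k$, the never condition $1N3$ on a set of linear orders means that in every order, $i$ is not ranked last among $i,j,k$; $3N1$ means that $k$ is not ranked first among $i,j,k$. For $B\subseteq[m]$, the set-alternating scheme generated by $B$ assigns to each triple $i<j<k$ in $[m]$ the condition $1N3$ if $j\in B$ and $3N1$ if $j\notin B$; $D_{[m]}(B)$ is the set of all linear orders on $[m]$ satisfying all assigned conditions, and $f_m(B)=|D_{[m]}(B)|$. -}

module Defs where

open import Data.Nat using (ℕ; zero; suc; _<ᵇ_)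
open import Data.Bool using (Bool; true; false; _∧_; _∨_; not; if_then_else_)
open import Data.Fin using (Fin; toℕ)
open import Data.Fin.Properties using (_≟_)
open import Data.List using (List; []; _∷_; map; concatMap; filter; length; allFin)
open import Data.Bool.ListAction using (all)
open import Data.Vec.Functional using (Vector) renaming ([] to []ᵛ; _∷_ to _∷ᵛ_)
open import Relation.Nullary.Decidable using (⌊_⌋)
open import Relation.Binary.PropositionalEquality using (_≡_)

SetOfAlts : Set
SetOfAlts = ℕ → Bool

-- Alternative with index x : Fin m is the alternative labelled suc (toℕ x) ∈ [m] = {1..m};
-- this preserves the natural order.
label : {m : ℕ} → Fin m → ℕ
label x = suc (toℕ x)

-- A linear order on [m] is encoded by its rank function pos : Fin m → Fin m
-- (pos x = rank of alternative x, rank 0 = first/best), required to be a bijection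
-- (equivalently, injective). x is ranked above y iff pos x < pos y.
above : {m : ℕ} → Vector (Fin m) m → Fin m → Fin m → Bool
above pos x y = toℕ (pos x) <ᵇ toℕ (pos y)

isOrder : {m : ℕ} → Vector (Fin m) m → Bool
isOrder {m} pos =
  all (λ x → all (λ y → ⌊ x ≟ y ⌋ ∨ not ⌊ pos x ≟ pos y ⌋) (allFin m)) (allFin m)

lt : {m : ℕ} → Fin m → Fin m → Bool
lt x y = toℕ x <ᵇ toℕ y

-- Never conditions on the triple i < j < k:
--   1N3 : i is not ranked last among i,j,k
--   3N1 : k is not ranked first among i,j,k
cond1N3 : {m : ℕ} → Vector (Fin m) m → Fin m → Fin m → Fin m → Bool
cond1N3 pos i j k = above pos i j ∨ above pos i k

cond3N1 : {m : ℕ} → Vector (Fin m) m → Fin m → Fin m → Fin m → Bool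
cond3N1 pos i j k = above pos i k ∨ above pos j k

satisfiesScheme : {m : ℕ} → SetOfAlts → Vector (Fin m) m → Bool
satisfiesScheme {m} B pos =
  all (λ i → all (λ j → all (λ k →
    not (lt i j ∧ lt j k) ∨
    (if B (label j) then cond1N3 pos i j k else cond3N1 pos i j k))
    (allFin m)) (allFin m)) (allFin m)

allVectors : (m k : ℕ) → List (Vector (Fin m) k)
allVectors m zero = []ᵛ ∷ []
allVectors m (suc k) =
  concatMap (λ x → map (λ v → x ∷ᵛ v) (allVectors m k)) (allFin m)

D : (m : ℕ) → SetOfAlts → List (Vector (Fin m) m)
D m B = filter (λ pos → (isOrder pos ∧ satisfiesScheme B pos) ≡? true) (allVectors m m)
  where
  open import Data.Bool.Properties using () renaming (_≟_ to _≡?_)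

f : ℕ → SetOfAlts → ℕ
f m B = length (D m B)

-- Write n = k + 2, so that w = n − 1 ∈ A. In every order of
-- D_[n](A) the alternative ranked last is n − 1 or n, since any i < n − 1 heads the triple
-- (i, n − 1, n), whose middle n − 1 ∈ A imposes 1N3. For either d ∈ {n − 1, n}, deleting d from
-- the orders of D_[n](A) that rank d last, and relabelling the remaining alternatives in order,
-- is a bijection onto D_[n−1](A′): the triples through d hold automatically because d is last,
-- and every other triple has its middle below n − 1, where A and A′ agree.

module Submission where

open import Defs
open import Algebra.Properties.CommutativeSemigroup using (interchange)
open import Data.Bool using (Bool; true; false; _∧_; _∨_; not; if_then_else_)
open import Data.Bool.ListAction using (all)
open import Data.Bool.Properties using (∨-zeroʳ; ∧-identityʳ; T-≡) renaming (_≟_ to _≟ᴮ_)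
open import Data.Empty using (⊥-elim)
open import Data.Fin using (Fin; toℕ; zero; suc; fromℕ; inject₁; punchIn; punchOut; pinch)
open import Data.Fin.Properties
  using (_≟_; toℕ<n; toℕ-fromℕ; toℕ-inject₁; toℕ-injective; inject₁-injective; fromℕ≢inject₁;
         punchIn-injective; punchInᵢ≢i; punchOut-cong; punchOut-punchIn; punchIn-punchOut;
         punchOut-injective; any?; pigeonhole)
open import Data.List using (List; []; _∷_; map; concat; concatMap; filter; length; allFin; tabulate; _++_)
open import Data.Nat using (ℕ; zero; suc; _+_; _*_; _∸_; _≤_; _<_; _≡ᵇ_; _<ᵇ_; s≤s; s<s; s≤s⁻¹)
open import Data.Nat.Properties
  using (+-commutativeSemigroup; +-assoc; +-identityʳ; *-identityʳ; ≡ᵇ⇒≡; <ᵇ⇒<; <⇒<ᵇ; <⇒≢;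
         ≤⇒≯; ≤∧≢⇒<; <-≤-trans; ≤-<-trans; ≤-antisym; ≤-refl; n≤1+n; n≮n)
open import Data.Product using (_×_; _,_; ∃)
open import Data.Sum using (_⊎_; inj₁; inj₂)
open import Data.Vec.Functional using (Vector) renaming (_∷_ to _∷ᵛ_)
open import Function using (_∘_; id)
open import Function.Bundles using (Equivalence)
open import Function.Definitions using (Injective)
open import Level using (Level)
open import Relation.Binary.PropositionalEquality
open import Relation.Nullary using (yes; no; Dec)
open import Relation.Nullary.Decidable using (does; ⌊_⌋; dec-true; dec-false)

open ≡-Reasoning

private
  variable
    ℓ ℓ′ : Level
    X : Set ℓ
    Y : Set ℓ′

∧-true : ∀ {a b} → a ∧ b ≡ true → a ≡ true × b ≡ true
∧-true {true} {true} _ = refl , refl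

true⇔true⇒≡ : ∀ {a b : Bool} → (a ≡ true → b ≡ true) → (b ≡ true → a ≡ true) → a ≡ b
true⇔true⇒≡ {true}           a⇒b b⇒a = sym (a⇒b refl)
true⇔true⇒≡ {false} {false} a⇒b b⇒a = refl
true⇔true⇒≡ {false} {true}  a⇒b b⇒a = b⇒a refl

does≡true⇒ : ∀ {a} {P : Set a} (p? : Dec P) → does p? ≡ true → P
does≡true⇒ (yes p) _ = p

<ᵇ≡true⇒< : ∀ {m n} → (m <ᵇ n) ≡ true → m < n
<ᵇ≡true⇒< {m} {n} = <ᵇ⇒< m n ∘ Equivalence.from T-≡

<⇒<ᵇ≡true : ∀ {m n} → m < n → (m <ᵇ n) ≡ true
<⇒<ᵇ≡true = Equivalence.to T-≡ ∘ <⇒<ᵇ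

≤⇒<ᵇ≡false : ∀ {m n} → n ≤ m → (m <ᵇ n) ≡ false
≤⇒<ᵇ≡false {m} {n} n≤m with m <ᵇ n in eq
... | true  = ⊥-elim (≤⇒≯ n≤m (<ᵇ≡true⇒< eq))
... | false = refl

<⇒≡ᵇ≡false : ∀ {m n} → m < n → (m ≡ᵇ n) ≡ false
<⇒≡ᵇ≡false {m} {n} m<n with m ≡ᵇ n in eq
... | true  = ⊥-elim (<⇒≢ m<n (≡ᵇ⇒≡ m n (Equivalence.from T-≡ eq)))
... | false = refl

indicator : Bool → ℕ
indicator true  = 1
indicator false = 0

sumBy : List X → (X → ℕ) → ℕ
sumBy []       h = 0
sumBy (x ∷ xs) h = h x + sumBy xs h

sumBy-cong : (xs : List X) {g h : X → ℕ} → (∀ x → g x ≡ h x) → sumBy xs g ≡ sumBy xs h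
sumBy-cong []       g≡h = refl
sumBy-cong (x ∷ xs) g≡h = cong₂ _+_ (g≡h x) (sumBy-cong xs g≡h)

sumBy-zero : (xs : List X) → sumBy xs (λ _ → 0) ≡ 0
sumBy-zero []       = refl
sumBy-zero (x ∷ xs) = sumBy-zero xs

sumBy-+ : (xs : List X) (g h : X → ℕ) → sumBy xs (λ x → g x + h x) ≡ sumBy xs g + sumBy xs h
sumBy-+ []       g h = refl
sumBy-+ (x ∷ xs) g h =
  trans (cong (g x + h x +_) (sumBy-+ xs g h))
        (interchange +-commutativeSemigroup (g x) (h x) (sumBy xs g) (sumBy xs h))

sumBy-++ : (xs ys : List X) (h : X → ℕ) → sumBy (xs ++ ys) h ≡ sumBy xs h + sumBy ys h
sumBy-++ []       ys h = refl
sumBy-++ (x ∷ xs) ys h = trans (cong (h x +_) (sumBy-++ xs ys h)) (sym (+-assoc (h x) _ _))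

sumBy-∧ˡ : (xs : List X) (b : Bool) (p : X → Bool) →
  sumBy xs (λ x → indicator (b ∧ p x)) ≡ indicator b * sumBy xs (indicator ∘ p)
sumBy-∧ˡ xs true  p = sym (+-identityʳ _)
sumBy-∧ˡ xs false p = sumBy-zero xs

sumBy-split : (xs : List X) (p q : X → Bool) → sumBy xs (indicator ∘ p) ≡
  sumBy xs (λ x → indicator (p x ∧ q x)) + sumBy xs (λ x → indicator (p x ∧ not (q x)))
sumBy-split xs p q = trans (sumBy-cong xs (λ x → split (p x) (q x))) (sumBy-+ xs _ _)
  where
  split : ∀ b c → indicator b ≡ indicator (b ∧ c) + indicator (b ∧ not c)
  split true  true  = refl
  split true  false = refl
  split false c     = refl

sumBy-map : (g : X → Y) (xs : List X) (h : Y → ℕ) → sumBy (map g xs) h ≡ sumBy xs (h ∘ g)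
sumBy-map g []       h = refl
sumBy-map g (x ∷ xs) h = cong (h (g x) +_) (sumBy-map g xs h)

sumBy-concatMap : (g : X → List Y) (xs : List X) (h : Y → ℕ) →
  sumBy (concatMap g xs) h ≡ sumBy xs (λ x → sumBy (g x) h)
sumBy-concatMap g []       h = refl
sumBy-concatMap g (x ∷ xs) h =
  trans (sumBy-++ (g x) (concat (map g xs)) h) (cong (sumBy (g x) h +_) (sumBy-concatMap g xs h))

sumBy-swap : (xs : List X) (ys : List Y) (h : X → Y → ℕ) →
  sumBy xs (λ x → sumBy ys (h x)) ≡ sumBy ys (λ y → sumBy xs (λ x → h x y))
sumBy-swap []       ys h = sym (sumBy-zero ys)
sumBy-swap (x ∷ xs) ys h =
  trans (cong (sumBy ys (h x) +_) (sumBy-swap xs ys h)) (sym (sumBy-+ ys (h x) _))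

sumBy-tabulate : ∀ n (g : Fin n → X) (h : X → ℕ) →
  sumBy (tabulate g) h ≡ sumBy (allFin n) (h ∘ g)
sumBy-tabulate zero    g h = refl
sumBy-tabulate (suc n) g h =
  cong (h (g zero) +_) (trans (sumBy-tabulate n (g ∘ suc) h) (sym (sumBy-tabulate n suc (h ∘ g))))

allFin-unique : ∀ {m} (c : Fin m) → sumBy (allFin m) (λ x → indicator (does (x ≟ c))) ≡ 1
allFin-unique {suc m} zero    = cong suc (trans (sumBy-tabulate m suc _) (sumBy-zero (allFin m)))
allFin-unique {suc m} (suc c) = trans (sumBy-tabulate m suc _) (allFin-unique {m} c)

_==ᵛ_ : ∀ {m k} → Vector (Fin m) k → Vector (Fin m) k → Bool
_==ᵛ_ {k = zero}  u v = true
_==ᵛ_ {k = suc k} u v = does (u zero ≟ v zero) ∧ (u ∘ suc) ==ᵛ (v ∘ suc)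

==ᵛ⇒≗ : ∀ {m k} (u v : Vector (Fin m) k) → u ==ᵛ v ≡ true → u ≗ v
==ᵛ⇒≗ {k = suc k} u v eq i with u zero ≟ v zero
==ᵛ⇒≗ {k = suc k} u v eq zero    | yes u₀≡v₀ = u₀≡v₀
==ᵛ⇒≗ {k = suc k} u v eq (suc i) | yes _     = ==ᵛ⇒≗ (u ∘ suc) (v ∘ suc) eq i

≗⇒==ᵛ : ∀ {m k} (u v : Vector (Fin m) k) → u ≗ v → u ==ᵛ v ≡ true
≗⇒==ᵛ {k = zero}  u v u≗v = refl
≗⇒==ᵛ {k = suc k} u v u≗v with u zero ≟ v zero
... | yes _     = ≗⇒==ᵛ (u ∘ suc) (v ∘ suc) (u≗v ∘ suc)
... | no u₀≢v₀  = ⊥-elim (u₀≢v₀ (u≗v zero))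

allVectors-unique : ∀ m k (v : Vector (Fin m) k) →
  sumBy (allVectors m k) (λ u → indicator (u ==ᵛ v)) ≡ 1
allVectors-unique m zero    v = refl
allVectors-unique m (suc k) v = begin
  sumBy (concatMap (λ x → map (x ∷ᵛ_) (allVectors m k)) (allFin m)) (λ u → indicator (u ==ᵛ v))
    ≡⟨ sumBy-concatMap _ (allFin m) _ ⟩
  sumBy (allFin m) (λ x → sumBy (map (x ∷ᵛ_) (allVectors m k)) (λ u → indicator (u ==ᵛ v)))
    ≡⟨ sumBy-cong (allFin m) head-matches ⟩
  sumBy (allFin m) (λ x → indicator (does (x ≟ v zero)))
    ≡⟨ allFin-unique (v zero) ⟩
  1 ∎
  where
  head-matches : ∀ x →
    sumBy (map (x ∷ᵛ_) (allVectors m k)) (λ u → indicator (u ==ᵛ v)) ≡ indicator (does (x ≟ v zero))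
  head-matches x = begin
    sumBy (map (x ∷ᵛ_) (allVectors m k)) (λ u → indicator (u ==ᵛ v))
      ≡⟨ sumBy-map (x ∷ᵛ_) (allVectors m k) _ ⟩
    sumBy (allVectors m k) (λ u → indicator (does (x ≟ v zero) ∧ u ==ᵛ (v ∘ suc)))
      ≡⟨ sumBy-∧ˡ (allVectors m k) (does (x ≟ v zero)) (_==ᵛ (v ∘ suc)) ⟩
    indicator (does (x ≟ v zero)) * sumBy (allVectors m k) (λ u → indicator (u ==ᵛ (v ∘ suc)))
      ≡⟨ cong (indicator (does (x ≟ v zero)) *_) (allVectors-unique m k (v ∘ suc)) ⟩
    indicator (does (x ≟ v zero)) * 1
      ≡⟨ *-identityʳ _ ⟩
    indicator (does (x ≟ v zero)) ∎

indicator≡sumBy-==ᵛ : ∀ m k (b : Bool) (v : Vector (Fin m) k) →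
  indicator b ≡ sumBy (allVectors m k) (λ u → indicator (b ∧ u ==ᵛ v))
indicator≡sumBy-==ᵛ m k b v = sym (begin
  sumBy (allVectors m k) (λ u → indicator (b ∧ u ==ᵛ v))
    ≡⟨ sumBy-∧ˡ (allVectors m k) b (_==ᵛ v) ⟩
  indicator b * sumBy (allVectors m k) (λ u → indicator (u ==ᵛ v))
    ≡⟨ cong (indicator b *_) (allVectors-unique m k v) ⟩
  indicator b * 1
    ≡⟨ *-identityʳ _ ⟩
  indicator b ∎)

count : (m k : ℕ) → (Vector (Fin m) k → Bool) → ℕ
count m k p = sumBy (allVectors m k) (indicator ∘ p)

length-filter≡sumBy : (p : X → Bool) (xs : List X) →
  length (filter (λ x → p x ≟ᴮ true) xs) ≡ sumBy xs (indicator ∘ p)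
length-filter≡sumBy p []       = refl
length-filter≡sumBy p (x ∷ xs) with p x
... | true  = cong suc (length-filter≡sumBy p xs)
... | false = length-filter≡sumBy p xs

Ranking : ℕ → Set
Ranking m = Vector (Fin m) m

inD : ∀ {m} → SetOfAlts → Ranking m → Bool
inD B pos = isOrder pos ∧ satisfiesScheme B pos

f≡count : ∀ m B → f m B ≡ count m m (inD B)
f≡count m B = length-filter≡sumBy (inD B) (allVectors m m)

RespectsPointwise : ∀ {m k} → (Vector (Fin m) k → Bool) → Set
RespectsPointwise p = ∀ u v → u ≗ v → p u ≡ p v

record Correspondence {a k b l} (p : Vector (Fin a) k → Bool) (q : Vector (Fin b) l → Bool) : Set where
  field
    to        : Vector (Fin a) k → Vector (Fin b) l
    from      : Vector (Fin b) l → Vector (Fin a) k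
    to-cong   : ∀ u v → u ≗ v → to u ≗ to v
    from-cong : ∀ u v → u ≗ v → from u ≗ from v
    to-sat    : ∀ v → p v ≡ true → q (to v) ≡ true
    from-sat  : ∀ u → q u ≡ true → p (from u) ≡ true
    from∘to   : ∀ v → p v ≡ true → from (to v) ≗ v
    to∘from   : ∀ u → q u ≡ true → to (from u) ≗ u

-- Double counting the pairs (v, u) with u = to v, equivalently v = from u.
count-correspondence : ∀ {a k b l} {p : Vector (Fin a) k → Bool} {q : Vector (Fin b) l → Bool} →
  RespectsPointwise p → RespectsPointwise q → Correspondence p q → count a k p ≡ count b l q
count-correspondence {a} {k} {b} {l} {p} {q} p-resp q-resp c = begin
  sumBy V (indicator ∘ p)
    ≡⟨ sumBy-cong V (λ v → indicator≡sumBy-==ᵛ b l (p v) (to v)) ⟩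
  sumBy V (λ v → sumBy U (λ u → indicator (p v ∧ u ==ᵛ to v)))
    ≡⟨ sumBy-swap V U _ ⟩
  sumBy U (λ u → sumBy V (λ v → indicator (p v ∧ u ==ᵛ to v)))
    ≡⟨ sumBy-cong U (λ u → sumBy-cong V (λ v → cong indicator (graph-symmetric u v))) ⟩
  sumBy U (λ u → sumBy V (λ v → indicator (q u ∧ v ==ᵛ from u)))
    ≡⟨ sumBy-cong U (λ u → sym (indicator≡sumBy-==ᵛ a k (q u) (from u))) ⟩
  sumBy U (indicator ∘ q) ∎
  where
  open Correspondence c
  V = allVectors a k
  U = allVectors b l
  graph-symmetric : ∀ u v → (p v ∧ u ==ᵛ to v) ≡ (q u ∧ v ==ᵛ from u)
  graph-symmetric u v = true⇔true⇒≡ forth back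
    where
    forth : p v ∧ u ==ᵛ to v ≡ true → q u ∧ v ==ᵛ from u ≡ true
    forth h with ∧-true {p v} h
    ... | pv , u=tov
      rewrite q-resp u (to v) (==ᵛ⇒≗ u (to v) u=tov) | to-sat v pv
      = ≗⇒==ᵛ v (from u) λ i →
          trans (sym (from∘to v pv i)) (from-cong (to v) u (λ j → sym (==ᵛ⇒≗ u (to v) u=tov j)) i)
    back : q u ∧ v ==ᵛ from u ≡ true → p v ∧ u ==ᵛ to v ≡ true
    back h with ∧-true {q u} h
    ... | qu , v=fromu
      rewrite p-resp v (from u) (==ᵛ⇒≗ v (from u) v=fromu) | from-sat u qu
      = ≗⇒==ᵛ u (to v) λ i →
          trans (sym (to∘from u qu i)) (to-cong (from u) v (λ j → sym (==ᵛ⇒≗ v (from u) v=fromu j)) i)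

schemeBody : (i<j j<l j∈B i≺j i≺l j≺l : Bool) → Bool
schemeBody i<j j<l j∈B i≺j i≺l j≺l = not (i<j ∧ j<l) ∨ (if j∈B then i≺j ∨ i≺l else i≺l ∨ j≺l)

schemeBody-cong : ∀ {a b c x y z a′ b′ c′ x′ y′ z′} →
  a ≡ a′ → b ≡ b′ → (a ∧ b ≡ true → c ≡ c′) → x ≡ x′ → y ≡ y′ → z ≡ z′ →
  schemeBody a b c x y z ≡ schemeBody a′ b′ c′ x′ y′ z′
schemeBody-cong {true}  {true}  refl refl c≡c′ refl refl refl rewrite c≡c′ refl = refl
schemeBody-cong {true}  {false} refl refl c≡c′ refl refl refl = refl
schemeBody-cong {false}         refl refl c≡c′ refl refl refl = refl

schemeBody-intro : ∀ a b c x y z → (a ∧ b ≡ true → (if c then x ∨ y else y ∨ z) ≡ true) →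
  schemeBody a b c x y z ≡ true
schemeBody-intro true  true  c x y z h rewrite h refl = refl
schemeBody-intro true  false c x y z h = refl
schemeBody-intro false b     c x y z h = refl

schemeAt : ∀ {m} → SetOfAlts → Ranking m → Fin m → Fin m → Fin m → Bool
schemeAt B pos i j l =
  schemeBody (lt i j) (lt j l) (B (label j)) (above pos i j) (above pos i l) (above pos j l)

schemeAt-cong : ∀ {m} B (pos : Ranking m) {i i′ j j′ l l′} →
  i ≡ i′ → j ≡ j′ → l ≡ l′ → schemeAt B pos i j l ≡ schemeAt B pos i′ j′ l′
schemeAt-cong B pos refl refl refl = refl

schemeAt-intro : ∀ {m} B (pos : Ranking m) i j l →
  (lt i j ∧ lt j l ≡ true →
     (if B (label j) then above pos i j ∨ above pos i l else above pos i l ∨ above pos j l) ≡ true) →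
  schemeAt B pos i j l ≡ true
schemeAt-intro B pos i j l =
  schemeBody-intro (lt i j) (lt j l) (B (label j)) (above pos i j) (above pos i l) (above pos j l)

Satisfies : ∀ {m} → SetOfAlts → Ranking m → Set
Satisfies B pos = ∀ i j l → schemeAt B pos i j l ≡ true

all-tabulate⁻ : ∀ {n} (g : Fin n → X) (p : X → Bool) → all p (tabulate g) ≡ true → ∀ i → p (g i) ≡ true
all-tabulate⁻ {n = suc n} g p h i with p (g zero) in eq
all-tabulate⁻ {n = suc n} g p h zero    | true = eq
all-tabulate⁻ {n = suc n} g p h (suc i) | true = all-tabulate⁻ (g ∘ suc) p h i

all-tabulate⁺ : ∀ {n} (g : Fin n → X) (p : X → Bool) → (∀ i → p (g i) ≡ true) → all p (tabulate g) ≡ true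
all-tabulate⁺ {n = zero}  g p h = refl
all-tabulate⁺ {n = suc n} g p h rewrite h zero = all-tabulate⁺ (g ∘ suc) p (h ∘ suc)

all-cong : (xs : List X) {p q : X → Bool} → (∀ x → p x ≡ q x) → all p xs ≡ all q xs
all-cong []       p≡q = refl
all-cong (x ∷ xs) p≡q = cong₂ _∧_ (p≡q x) (all-cong xs p≡q)

isOrder⇒injective : ∀ {m} (pos : Ranking m) → isOrder pos ≡ true → Injective _≡_ _≡_ pos
isOrder⇒injective pos h {x} {y} pos-x≡pos-y
  with all-tabulate⁻ id _ (all-tabulate⁻ id _ h x) y
... | distinct-xy with x ≟ y | pos x ≟ pos y
... | yes x≡y | _          = x≡y
... | no _    | no pos-x≢y = ⊥-elim (pos-x≢y pos-x≡pos-y)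

injective⇒isOrder : ∀ {m} (pos : Ranking m) → Injective _≡_ _≡_ pos → isOrder pos ≡ true
injective⇒isOrder pos inj = all-tabulate⁺ id _ λ x → all-tabulate⁺ id _ λ y → distinct x y
  where
  distinct : ∀ x y → ⌊ x ≟ y ⌋ ∨ not ⌊ pos x ≟ pos y ⌋ ≡ true
  distinct x y with x ≟ y | pos x ≟ pos y
  ... | yes _   | _             = refl
  ... | no _    | no _          = refl
  ... | no x≢y  | yes pos-x≡y   = ⊥-elim (x≢y (inj pos-x≡y))

inD⇒ : ∀ {m} B (pos : Ranking m) → inD B pos ≡ true → Injective _≡_ _≡_ pos × Satisfies B pos
inD⇒ B pos h with ∧-true {isOrder pos} h
... | order , sat =
  isOrder⇒injective pos order ,
  λ i j l → all-tabulate⁻ id _ (all-tabulate⁻ id _ (all-tabulate⁻ id _ sat i) j) l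

⇒inD : ∀ {m} B (pos : Ranking m) → Injective _≡_ _≡_ pos → Satisfies B pos → inD B pos ≡ true
⇒inD B pos inj sat
  rewrite injective⇒isOrder pos inj
        | all-tabulate⁺ id _ (λ i → all-tabulate⁺ id _ λ j → all-tabulate⁺ id _ λ l → sat i j l) = refl

inD-respects-≗ : ∀ {m} B → RespectsPointwise {m} {m} (inD B)
inD-respects-≗ {m} B u v u≗v = cong₂ _∧_
  (all-cong (allFin m) λ x → all-cong (allFin m) λ y →
     cong (λ b → ⌊ x ≟ y ⌋ ∨ not b) (cong₂ (λ p q → ⌊ p ≟ q ⌋) (u≗v x) (u≗v y)))
  (all-cong (allFin m) λ i → all-cong (allFin m) λ j → all-cong (allFin m) λ l →
     schemeBody-cong {lt i j} {lt j l} {B (label j)} refl refl (λ _ → refl)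
       (above-≗ i j) (above-≗ i l) (above-≗ j l))
  where
  above-≗ : ∀ x y → above u x y ≡ above v x y
  above-≗ x y = cong₂ (λ p q → toℕ p <ᵇ toℕ q) (u≗v x) (u≗v y)

lt⇒toℕ< : ∀ {k} (x y : Fin (suc k)) → lt x y ≡ true → toℕ x < k
lt⇒toℕ< x y x<y = <-≤-trans (<ᵇ≡true⇒< x<y) (s≤s⁻¹ (toℕ<n y))

lastRank : ∀ {k} → Fin (suc k)
lastRank = fromℕ _

≢lastRank⇒toℕ< : ∀ {k} (z : Fin (suc k)) → z ≢ lastRank → toℕ z < k
≢lastRank⇒toℕ< {k} z z≢last =
  ≤∧≢⇒< (s≤s⁻¹ (toℕ<n z)) (λ z≡k → z≢last (toℕ-injective (trans z≡k (sym (toℕ-fromℕ k)))))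

lowerLast : ∀ {k} → Fin (suc (suc k)) → Fin (suc k)
lowerLast = pinch lastRank

toℕ-lowerLast : ∀ {k} (z : Fin (suc (suc k))) → toℕ z < suc k → toℕ (lowerLast z) ≡ toℕ z
toℕ-lowerLast {zero}  zero    _         = refl
toℕ-lowerLast {zero}  (suc z) (s<s ())
toℕ-lowerLast {suc k} zero    _         = refl
toℕ-lowerLast {suc k} (suc z) (s<s z<k) = cong suc (toℕ-lowerLast z z<k)

lowerLast-inject₁ : ∀ {k} (z : Fin (suc k)) → lowerLast (inject₁ z) ≡ z
lowerLast-inject₁ {zero}  zero    = refl
lowerLast-inject₁ {suc k} zero    = refl
lowerLast-inject₁ {suc k} (suc z) = cong suc (lowerLast-inject₁ z)

inject₁-lowerLast : ∀ {k} (z : Fin (suc (suc k))) → z ≢ lastRank → inject₁ (lowerLast z) ≡ z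
inject₁-lowerLast z z≢last =
  toℕ-injective (trans (toℕ-inject₁ _) (toℕ-lowerLast z (≢lastRank⇒toℕ< z z≢last)))

toℕ-punchIn-< : ∀ {n} (d : Fin (suc n)) (x : Fin n) → toℕ x < toℕ d → toℕ (punchIn d x) ≡ toℕ x
toℕ-punchIn-< (suc d) zero    _         = refl
toℕ-punchIn-< (suc d) (suc x) (s<s x<d) = cong suc (toℕ-punchIn-< d x x<d)

lt-punchIn : ∀ {n} (d : Fin (suc n)) (x y : Fin n) → lt (punchIn d x) (punchIn d y) ≡ lt x y
lt-punchIn zero    x       y       = refl
lt-punchIn (suc d) zero    zero    = refl
lt-punchIn (suc d) zero    (suc y) = refl
lt-punchIn (suc d) (suc x) zero    = refl
lt-punchIn (suc d) (suc x) (suc y) = lt-punchIn d x y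

lastRanked-not-above : ∀ {k} (pos : Ranking (suc k)) x y → pos x ≡ lastRank → above pos x y ≡ false
lastRanked-not-above {k} pos x y pos-x≡last = ≤⇒<ᵇ≡false
  (subst (toℕ (pos y) ≤_) (sym (trans (cong toℕ pos-x≡last) (toℕ-fromℕ k))) (s≤s⁻¹ (toℕ<n (pos y))))

above-lastRanked : ∀ {k} (pos : Ranking (suc k)) x y →
  pos x ≢ lastRank → pos y ≡ lastRank → above pos x y ≡ true
above-lastRanked {k} pos x y pos-x≢last pos-y≡last = <⇒<ᵇ≡true
  (subst (toℕ (pos x) <_) (sym (trans (cong toℕ pos-y≡last) (toℕ-fromℕ k))) (≢lastRank⇒toℕ< _ pos-x≢last))

injective⇒surjective : ∀ {m} (pos : Ranking m) → Injective _≡_ _≡_ pos → ∀ y → ∃ λ x → pos x ≡ y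
injective⇒surjective {suc m} pos inj y with any? (λ x → pos x ≟ y)
... | yes hit = hit
... | no miss with pigeonhole ≤-refl (λ x → punchOut (miss ∘ (x ,_) ∘ sym))
... | i , j , i<j , collision =
  ⊥-elim (<⇒≢ i<j (cong toℕ (inj
    (punchOut-injective (miss ∘ (i ,_) ∘ sym) (miss ∘ (j ,_) ∘ sym) collision))))

1N3⇒not-last : ∀ {k} B (pos : Ranking (suc k)) i j l →
  lt i j ≡ true → lt j l ≡ true → B (label j) ≡ true → schemeAt B pos i j l ≡ true → pos i ≢ lastRank
1N3⇒not-last B pos i j l i<j j<l j∈B holds i-last
  rewrite i<j | j<l | j∈B | lastRanked-not-above pos i j i-last | lastRanked-not-above pos i l i-last
  with () ← holds

inD∧last : ∀ {m} → SetOfAlts → Fin (suc m) → Ranking (suc m) → Bool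
inD∧last B d pos = inD B pos ∧ does (pos d ≟ lastRank)

without : SetOfAlts → ℕ → SetOfAlts
without A w x = A x ∧ not (x ≡ᵇ w)

module LastRanked (k : ℕ) (A : SetOfAlts) (k+1∈A : A (suc k) ≡ true)
                  (d : Fin (suc (suc k))) (k≤d : k ≤ toℕ d) where

  A′ : SetOfAlts
  A′ = without A (suc k)

  OnlyDLast : Ranking (suc (suc k)) → Set
  OnlyDLast pos = ∀ x → x ≢ d → pos x ≢ lastRank

  delete : Ranking (suc (suc k)) → Ranking (suc k)
  delete pos x = lowerLast (pos (punchIn d x))

  insert : Ranking (suc k) → Ranking (suc (suc k))
  insert pos′ x with d ≟ x
  ... | yes _   = lastRank
  ... | no d≢x  = inject₁ (pos′ (punchOut d≢x))

  insert-d : ∀ pos′ → insert pos′ d ≡ lastRank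
  insert-d pos′ with d ≟ d
  ... | yes _   = refl
  ... | no d≢d  = ⊥-elim (d≢d refl)

  insert-≢d : ∀ pos′ x (d≢x : d ≢ x) → insert pos′ x ≡ inject₁ (pos′ (punchOut d≢x))
  insert-≢d pos′ x d≢x with d ≟ x
  ... | yes d≡x = ⊥-elim (d≢x d≡x)
  ... | no _    = cong (inject₁ ∘ pos′) (punchOut-cong d refl)

  insert-onlyDLast : ∀ pos′ → OnlyDLast (insert pos′)
  insert-onlyDLast pos′ x x≢d last = fromℕ≢inject₁ (trans (sym last) (insert-≢d pos′ x (x≢d ∘ sym)))

  insert-cong : ∀ u v → u ≗ v → insert u ≗ insert v
  insert-cong u v u≗v x with d ≟ x
  ... | yes _   = refl
  ... | no d≢x  = cong inject₁ (u≗v (punchOut d≢x))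

  delete-insert : ∀ pos′ → delete (insert pos′) ≗ pos′
  delete-insert pos′ x = begin
    lowerLast (insert pos′ (punchIn d x))
      ≡⟨ cong lowerLast (insert-≢d pos′ _ d≢dx) ⟩
    lowerLast (inject₁ (pos′ (punchOut d≢dx)))
      ≡⟨ lowerLast-inject₁ _ ⟩
    pos′ (punchOut d≢dx)
      ≡⟨ cong pos′ (trans (punchOut-cong d refl) (punchOut-punchIn d)) ⟩
    pos′ x ∎
    where
    d≢dx : d ≢ punchIn d x
    d≢dx = punchInᵢ≢i d x ∘ sym

  insert-delete : ∀ pos → pos d ≡ lastRank → OnlyDLast pos → insert (delete pos) ≗ pos
  insert-delete pos pos-d≡last only x with d ≟ x
  ... | yes refl = sym pos-d≡last
  ... | no d≢x   = trans (cong (inject₁ ∘ lowerLast ∘ pos) (punchIn-punchOut d≢x))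
                         (inject₁-lowerLast (pos x) (only x (d≢x ∘ sym)))

  toℕ-delete : ∀ pos → OnlyDLast pos → ∀ x → toℕ (delete pos x) ≡ toℕ (pos (punchIn d x))
  toℕ-delete pos only x =
    toℕ-lowerLast _ (≢lastRank⇒toℕ< _ (only (punchIn d x) (punchInᵢ≢i d x)))

  insert-injective : ∀ pos′ → Injective _≡_ _≡_ pos′ → Injective _≡_ _≡_ (insert pos′)
  insert-injective pos′ inj {x} {y} eq = cases (d ≟ x) (d ≟ y)
    where
    cases : Dec (d ≡ x) → Dec (d ≡ y) → x ≡ y
    cases (yes d≡x) (yes d≡y) = trans (sym d≡x) d≡y
    cases (yes refl) (no d≢y) = ⊥-elim (insert-onlyDLast pos′ y (d≢y ∘ sym) (trans (sym eq) (insert-d pos′)))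
    cases (no d≢x) (yes refl) = ⊥-elim (insert-onlyDLast pos′ x (d≢x ∘ sym) (trans eq (insert-d pos′)))
    cases (no d≢x) (no d≢y)   = punchOut-injective d≢x d≢y (inj (inject₁-injective
      (trans (sym (insert-≢d pos′ x d≢x)) (trans eq (insert-≢d pos′ y d≢y)))))

  delete-injective : ∀ pos → Injective _≡_ _≡_ pos → OnlyDLast pos → Injective _≡_ _≡_ (delete pos)
  delete-injective pos inj only {x} {y} eq = punchIn-injective d x y (inj (toℕ-injective
    (trans (sym (toℕ-delete pos only x)) (trans (cong toℕ eq) (toℕ-delete pos only y)))))

  -- Triples avoiding d: its middle lies below k, where A′ agrees with A and punchIn d is the identity.
  schemeAt-delete : ∀ pos → OnlyDLast pos → ∀ i j l →
    schemeAt A′ (delete pos) i j l ≡ schemeAt A pos (punchIn d i) (punchIn d j) (punchIn d l)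
  schemeAt-delete pos only i j l = schemeBody-cong
    (sym (lt-punchIn d i j)) (sym (lt-punchIn d j l)) middle
    (above-delete i j) (above-delete i l) (above-delete j l)
    where
    above-delete : ∀ x y → above (delete pos) x y ≡ above pos (punchIn d x) (punchIn d y)
    above-delete x y = cong₂ _<ᵇ_ (toℕ-delete pos only x) (toℕ-delete pos only y)
    middle : lt i j ∧ lt j l ≡ true → A′ (label j) ≡ A (label (punchIn d j))
    middle i<j<l with ∧-true {lt i j} i<j<l
    ... | _ , j<l = begin
      A (label j) ∧ not (label j ≡ᵇ suc k)
        ≡⟨ cong (λ b → A (label j) ∧ not b) (<⇒≡ᵇ≡false (s<s j<k)) ⟩
      A (label j) ∧ true
        ≡⟨ ∧-identityʳ _ ⟩
      A (label j)
        ≡⟨ cong (A ∘ suc) (toℕ-punchIn-< d j (<-≤-trans j<k k≤d)) ⟨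
      A (label (punchIn d j)) ∎
      where
      j<k : toℕ j < k
      j<k = lt⇒toℕ< j l j<l

  satisfies-delete : ∀ pos → OnlyDLast pos → Satisfies A pos → Satisfies A′ (delete pos)
  satisfies-delete pos only sat i j l = trans (schemeAt-delete pos only i j l) (sat _ _ _)

  d<l⇒d≡k : ∀ l → lt d l ≡ true → toℕ d ≡ k
  d<l⇒d≡k l d<l = ≤-antisym (s≤s⁻¹ (lt⇒toℕ< d l d<l)) k≤d

  -- Triples through d hold because d is last: d is never the first element of a triple (only
  -- alternative n exceeds it), and as a middle it is n − 1 ∈ A, whose 1N3 only asks i to beat d.
  satisfies-insert : ∀ pos′ → Satisfies A′ pos′ → Satisfies A (insert pos′)
  satisfies-insert pos′ sat i j l = by-position i j l (d ≟ i) (d ≟ j) (d ≟ l)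
    where
    pos = insert pos′
    i-beats-d : ∀ i → d ≢ i → above pos i d ≡ true
    i-beats-d i d≢i = above-lastRanked pos i d (insert-onlyDLast pos′ i (d≢i ∘ sym)) (insert-d pos′)
    above-pointwise : ∀ x y → above (delete pos) x y ≡ above pos′ x y
    above-pointwise x y = cong₂ (λ p q → toℕ p <ᵇ toℕ q) (delete-insert pos′ x) (delete-insert pos′ y)
    by-position : ∀ i j l → Dec (d ≡ i) → Dec (d ≡ j) → Dec (d ≡ l) → schemeAt A pos i j l ≡ true
    by-position i j l (no d≢i) (no d≢j) (no d≢l) = begin
      schemeAt A pos i j l
        ≡⟨ schemeAt-cong A pos (punchIn-punchOut d≢i) (punchIn-punchOut d≢j) (punchIn-punchOut d≢l) ⟨
      schemeAt A pos (punchIn d i′) (punchIn d j′) (punchIn d l′)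
        ≡⟨ schemeAt-delete pos (insert-onlyDLast pos′) i′ j′ l′ ⟨
      schemeAt A′ (delete pos) i′ j′ l′
        ≡⟨ schemeBody-cong {lt i′ j′} {lt j′ l′} {A′ (label j′)} refl refl (λ _ → refl)
             (above-pointwise i′ j′) (above-pointwise i′ l′) (above-pointwise j′ l′) ⟩
      schemeAt A′ pos′ i′ j′ l′
        ≡⟨ sat i′ j′ l′ ⟩
      true ∎
      where
      i′ = punchOut d≢i
      j′ = punchOut d≢j
      l′ = punchOut d≢l
    by-position _ j l (yes refl) _ _ = schemeAt-intro A pos d j l λ d<j<l →
      let d<j , j<l = ∧-true {lt d j} d<j<l in
      ⊥-elim (n≮n k (≤-<-trans k≤d (<-≤-trans (<ᵇ≡true⇒< d<j) (s≤s⁻¹ (lt⇒toℕ< j l j<l)))))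
    by-position i _ l (no d≢i) (yes refl) _ = schemeAt-intro A pos i d l λ i<d<l →
      let _ , d<l = ∧-true {lt i d} i<d<l in
      subst (λ c → (if c then above pos i d ∨ above pos i l else above pos i l ∨ above pos d l) ≡ true)
        (sym (trans (cong (A ∘ suc) (d<l⇒d≡k l d<l)) k+1∈A))
        (cong (_∨ above pos i l) (i-beats-d i d≢i))
    by-position i j _ (no d≢i) _ (yes refl) = schemeAt-intro A pos i j d λ _ →
      subst (λ x → (if A (label j) then above pos i j ∨ x else x ∨ above pos j d) ≡ true)
        (sym (i-beats-d i d≢i)) (either-branch (A (label j)) (above pos i j))
      where
      either-branch : ∀ c x → (if c then x ∨ true else true) ≡ true
      either-branch true  x = ∨-zeroʳ x
      either-branch false x = refl

  correspondence : Correspondence (inD∧last A d) (inD A′)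
  correspondence = record
    { to        = delete
    ; from      = insert
    ; to-cong   = λ u v u≗v x → cong lowerLast (u≗v (punchIn d x))
    ; from-cong = insert-cong
    ; to-sat    = to-sat
    ; from-sat  = from-sat
    ; from∘to   = λ pos h → let inj , _ , d-last = decode pos h in
                            insert-delete pos d-last (only inj d-last)
    ; to∘from   = λ pos′ _ → delete-insert pos′
    }
    where
    decode : ∀ pos → inD∧last A d pos ≡ true →
      Injective _≡_ _≡_ pos × Satisfies A pos × pos d ≡ lastRank
    decode pos h with ∧-true {inD A pos} h
    ... | admissible , d-last with inD⇒ A pos admissible
    ... | inj , sat = inj , sat , does≡true⇒ (pos d ≟ lastRank) d-last
    only : ∀ {pos} → Injective _≡_ _≡_ pos → pos d ≡ lastRank → OnlyDLast pos
    only inj d-last x x≢d x-last = x≢d (inj (trans x-last (sym d-last)))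
    to-sat : ∀ pos → inD∧last A d pos ≡ true → inD A′ (delete pos) ≡ true
    to-sat pos h with decode pos h
    ... | inj , sat , d-last = ⇒inD A′ (delete pos)
      (delete-injective pos inj (only inj d-last)) (satisfies-delete pos (only inj d-last) sat)
    from-sat : ∀ pos′ → inD A′ pos′ ≡ true → inD∧last A d (insert pos′) ≡ true
    from-sat pos′ h with inD⇒ A′ pos′ h
    ... | inj , sat
      rewrite ⇒inD A (insert pos′) (insert-injective pos′ inj) (satisfies-insert pos′ sat) =
      dec-true (insert pos′ d ≟ lastRank) (insert-d pos′)

  inD∧last-respects-≗ : RespectsPointwise (inD∧last A d)
  inD∧last-respects-≗ u v u≗v =
    cong₂ _∧_ (inD-respects-≗ A u v u≗v) (cong (λ p → does (p ≟ lastRank)) (u≗v d))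

  count-inD∧last : count (suc (suc k)) (suc (suc k)) (inD∧last A d) ≡ f (suc k) A′
  count-inD∧last = trans
    (count-correspondence inD∧last-respects-≗ (inD-respects-≗ A′) correspondence)
    (sym (f≡count (suc k) A′))

largest secondLargest : ∀ {k} → Fin (suc (suc k))
largest           = fromℕ _
secondLargest {k} = inject₁ (fromℕ k)

largest≢secondLargest : ∀ {k} → largest {k} ≢ secondLargest
largest≢secondLargest = fromℕ≢inject₁

toℕ-largest : ∀ k → toℕ (largest {k}) ≡ suc k
toℕ-largest k = toℕ-fromℕ (suc k)

toℕ-secondLargest : ∀ k → toℕ (secondLargest {k}) ≡ k
toℕ-secondLargest k = trans (toℕ-inject₁ (fromℕ k)) (toℕ-fromℕ k)

module LastTwo (k : ℕ) (A : SetOfAlts) (k+1∈A : A (suc k) ≡ true) where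

  n : ℕ
  n = suc (suc k)

  last-is-largest⊎secondLargest : ∀ (pos : Ranking n) → inD A pos ≡ true →
    pos largest ≡ lastRank ⊎ pos secondLargest ≡ lastRank
  last-is-largest⊎secondLargest pos admissible with inD⇒ A pos admissible
  ... | inj , sat with injective⇒surjective pos inj lastRank
  ... | x , x-last with x ≟ largest | x ≟ secondLargest
  ... | yes refl | _        = inj₁ x-last
  ... | no _     | yes refl = inj₂ x-last
  ... | no x≢l   | no x≢s   = ⊥-elim (1N3⇒not-last A pos x secondLargest largest
      (<⇒<ᵇ≡true (subst (toℕ x <_) (sym (toℕ-secondLargest k)) x<k))
      (<⇒<ᵇ≡true (subst₂ _<_ (sym (toℕ-secondLargest k)) (sym (toℕ-largest k)) ≤-refl))
      (trans (cong (A ∘ suc) (toℕ-secondLargest k)) k+1∈A)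
      (sat x secondLargest largest) x-last)
    where
    x<k : toℕ x < k
    x<k = ≤∧≢⇒< (s≤s⁻¹ (≢lastRank⇒toℕ< x x≢l))
                (λ x≡k → x≢s (toℕ-injective (trans x≡k (sym (toℕ-secondLargest k)))))

  largest-not-last≡secondLargest-last : ∀ (pos : Ranking n) →
    (inD A pos ∧ not (does (pos largest ≟ lastRank))) ≡ inD∧last A secondLargest pos
  largest-not-last≡secondLargest-last pos with inD A pos in admissible
  ... | false = refl
  ... | true with inD⇒ A pos admissible | last-is-largest⊎secondLargest pos admissible
  ... | inj , _ | inj₁ l-last
    rewrite dec-true (pos largest ≟ lastRank) l-last
          | dec-false (pos secondLargest ≟ lastRank)
                      (λ s-last → largest≢secondLargest (inj (trans l-last (sym s-last)))) = refl
  ... | inj , _ | inj₂ s-last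
    rewrite dec-true (pos secondLargest ≟ lastRank) s-last
          | dec-false (pos largest ≟ lastRank)
                      (λ l-last → largest≢secondLargest (inj (trans l-last (sym s-last)))) = refl

  count-inD≡largest-last+secondLargest-last :
    count n n (inD A) ≡ count n n (inD∧last A largest) + count n n (inD∧last A secondLargest)
  count-inD≡largest-last+secondLargest-last =
    trans (sumBy-split (allVectors n n) (inD A) (λ pos → does (pos largest ≟ lastRank)))
          (cong (count n n (inD∧last A largest) +_)
                (sumBy-cong (allVectors n n) (cong indicator ∘ largest-not-last≡secondLargest-last)))

mainTheorem5 : (n : ℕ) → 2 ≤ n → (A : SetOfAlts) →
    (∀ x → A x ≡ true → 1 ≤ x × x ≤ n) →
    (w : ℕ) → A w ≡ true → (∀ x → A x ≡ true → x ≤ w) →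
    w ≡ n ∸ 1 →
    f n A ≡ 2 * f (n ∸ 1) (λ x → A x ∧ not (x ≡ᵇ w))
mainTheorem5 (suc (suc k)) _ A _ .(suc k) k+1∈A _ refl = begin
  f n A
    ≡⟨ f≡count n A ⟩
  count n n (inD A)
    ≡⟨ count-inD≡largest-last+secondLargest-last ⟩
  count n n (inD∧last A largest) + count n n (inD∧last A secondLargest)
    ≡⟨ cong₂ _+_ (LastRanked.count-inD∧last k A k+1∈A largest k≤largest)
                 (LastRanked.count-inD∧last k A k+1∈A secondLargest k≤secondLargest) ⟩
  f (suc k) A′ + f (suc k) A′
    ≡⟨ cong (f (suc k) A′ +_) (+-identityʳ _) ⟨
  2 * f (suc k) A′ ∎
  where
  open LastTwo k A k+1∈A
  A′ = without A (suc k)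
  k≤largest : k ≤ toℕ (largest {k})
  k≤largest = subst (k ≤_) (sym (toℕ-largest k)) (n≤1+n k)
  k≤secondLargest : k ≤ toℕ (secondLargest {k})
  k≤secondLargest = subst (k ≤_) (sym (toℕ-secondLargest k)) ≤-refl
mainTheorem5 (suc zero) (s≤s ()) _ _ _ _ _ _
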